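{- Let $\phi = \frac{1+\sqrt5}{2}$, $a(k) = \lfloor k\phi\rfloor$ and $c(k) = a(k)+2k-1$. Then for every positive integer $k$, \[ \{c(k)\phi\} = \begin{cases} \frac{\sqrt5}{\phi}\{k\phi\} + \frac{1-\sqrt5}{2}, & \text{if } \{k\phi\} > \frac{1}{\sqrt5},\\[0.3em] \frac{\sqrt5}{\phi}\{k\phi\} + \frac{3-\sqrt5}{2}, & \text{if } \{k\phi\} < \frac{1}{\sqrt5}.\end{cases} \]
   Context: $\{x\} = x - \lfloor x\rfloor$ denotes the fractional part. -}

module Defs where

open import Data.Nat using (ℕ)
open import Data.Integer as ℤ using (ℤ)
open import Data.Rational as ℚ using (ℚ; 0ℚ; 1ℚ; NonZero)
open import Data.Product using (_×_)
open import Data.Sum using (_⊎_)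
open import Relation.Binary.PropositionalEquality using (_≡_)

-- The field ℚ(√5): the number  re + im·√5  (exact real arithmetic for φ).
record ℚ√5 : Set where
  constructor _+√5·_
  field
    re : ℚ
    im : ℚ
open ℚ√5 public

inj : ℚ → ℚ√5
inj q = q +√5· 0ℚ

fromℤ : ℤ → ℚ√5
fromℤ n = inj (n ℚ./ 1)

fromℕ : ℕ → ℚ√5
fromℕ n = fromℤ (ℤ.+ n)

infixl 6 _⊕_ _⊖_
infixl 7 _⊗_ _÷_

_⊕_ : ℚ√5 → ℚ√5 → ℚ√5
(a +√5· b) ⊕ (c +√5· d) = (a ℚ.+ c) +√5· (b ℚ.+ d)

neg : ℚ√5 → ℚ√5
neg (a +√5· b) = (ℚ.- a) +√5· (ℚ.- b)

_⊖_ : ℚ√5 → ℚ√5 → ℚ√5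
x ⊖ y = x ⊕ neg y

five : ℚ
five = ℤ.+ 5 ℚ./ 1

_⊗_ : ℚ√5 → ℚ√5 → ℚ√5
(a +√5· b) ⊗ (c +√5· d) = (a ℚ.* c ℚ.+ five ℚ.* (b ℚ.* d)) +√5· (a ℚ.* d ℚ.+ b ℚ.* c)

norm : ℚ√5 → ℚ
norm (a +√5· b) = a ℚ.* a ℚ.- five ℚ.* (b ℚ.* b)

-- division: x / y = x · conj(y) / norm(y)   (y ≠ 0 iff norm y ≠ 0)
_÷_ : (x y : ℚ√5) → .{{NonZero (norm y)}} → ℚ√5
_÷_ x (c +√5· d) = x ⊗ ((c ℚ.* n⁻¹) +√5· ((ℚ.- d) ℚ.* n⁻¹))
  where n⁻¹ = ℚ.1/ (norm (c +√5· d))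

√5 : ℚ√5
√5 = 0ℚ +√5· 1ℚ

φ : ℚ√5
φ = (ℤ.+ 1 ℚ./ 2) +√5· (ℤ.+ 1 ℚ./ 2)

-- The order on ℚ(√5) induced by the embedding into ℝ (√5 the positive root):
-- a + b√5 > 0.
Positive : ℚ√5 → Set
Positive (a +√5· b) =
    (0ℚ ℚ.< a × 0ℚ ℚ.≤ b)
  ⊎ (0ℚ ℚ.≤ a × 0ℚ ℚ.< b)
  ⊎ (0ℚ ℚ.< a × b ℚ.< 0ℚ × five ℚ.* (b ℚ.* b) ℚ.< a ℚ.* a)
  ⊎ (a ℚ.< 0ℚ × 0ℚ ℚ.< b × a ℚ.* a ℚ.< five ℚ.* (b ℚ.* b))

infix 4 _<ᵣ_ _≤ᵣ_
_<ᵣ_ : ℚ√5 → ℚ√5 → Set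
x <ᵣ y = Positive (y ⊖ x)

_≤ᵣ_ : ℚ√5 → ℚ√5 → Set
x ≤ᵣ y = x ≡ y ⊎ x <ᵣ y

IsFloor : ℚ√5 → ℤ → Set
IsFloor x n = fromℤ n ≤ᵣ x × x <ᵣ fromℤ (n ℤ.+ ℤ.1ℤ)

-- fractional part {x} = x - ⌊x⌋, given n = ⌊x⌋
frac : ℚ√5 → ℤ → ℚ√5
frac x n = x ⊖ fromℤ n

cfun : ℕ → ℤ → ℤ
cfun k a = a ℤ.+ (ℤ.+ 2) ℤ.* (ℤ.+ k) ℤ.- ℤ.1ℤ

ι : ℕ → ℚ√5
ι n = fromℕ n

module Submission where

-- Idea: since φ² = φ + 1 and λφ = √5, one has exactly cφ = (3a + k) + λf - φ.
-- So cφ minus the integer 3a + k - 1 (resp. 3a + k - 2) is λf + (1 - φ)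
-- (resp. λf + (2 - φ)), and it only remains to see that this lies in [0, 1),
-- which follows from 1/√5 < f < 1 (resp. 0 ≤ f < 1/√5) since λ > 0.

open import Defs
open import Data.Nat using (ℕ; zero; suc; _≤_)
open import Data.Empty using (⊥; ⊥-elim)
open import Data.Sum using (_⊎_; inj₁; inj₂)
open import Data.Product using (_×_; _,_; proj₁; proj₂)
open import Level using (0ℓ)
open import Relation.Binary.PropositionalEquality using (_≡_; refl; sym; trans; cong; cong₂; subst; subst₂; isEquivalence; module ≡-Reasoning)
open import Algebra.Bundles using (CommutativeRing)
open import Algebra.Structures using (IsCommutativeRing)
import Algebra.Solver.Ring.Simple
import Algebra.Solver.Ring.AlmostCommutativeRing as ACR
open import Relation.Binary.Definitions using (Decidable; tri<; tri≈; tri>)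
open import Relation.Nullary using (yes; no)
open import Relation.Nullary.Decidable using (True; toWitness; map′; _×-dec_)
open import Data.Integer as ℤ using (ℤ)
import Data.Integer.Properties as ℤP
open import Data.Integer.Solver using () renaming (module +-*-Solver to ℤ-Solver)
open ℤ-Solver using () renaming (solve to ℤsolve; _:=_ to _⊜ℤ_; _:+_ to _⊕ℤ_; _:-_ to _⊝_)
import Data.Nat.Coprimality as ℕC
open import Data.Rational as ℚ using (ℚ; 0ℚ; 1ℚ; mkℚ; _+_; _*_; -_; _-_)
import Data.Rational.Properties as ℚP
open import Data.Rational.Solver using (module +-*-Solver)
open +-*-Solver using (solve; _:=_; con; _:+_; _:*_; :-_; _:-_)

Pos NonNeg : ℚ → Set
Pos x = 0ℚ ℚ.< x
NonNeg x = 0ℚ ℚ.≤ x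

lit : ℕ → ℚ
lit n = ℤ.+ n ℚ./ 1

by-eval< : ∀ {p q} → True (p ℚP.<? q) → p ℚ.< q
by-eval< = toWitness

by-eval≤ : ∀ {p q} → True (p ℚP.≤? q) → p ℚ.≤ q
by-eval≤ = toWitness

pos⇒nonNeg : ∀ {x} → Pos x → NonNeg x
pos⇒nonNeg = ℚP.<⇒≤

pos+nonNeg : ∀ {x y} → Pos x → NonNeg y → Pos (x + y)
pos+nonNeg = ℚP.+-mono-<-≤

nonNeg+nonNeg : ∀ {x y} → NonNeg x → NonNeg y → NonNeg (x + y)
nonNeg+nonNeg = ℚP.+-mono-≤

pos*pos : ∀ {x y} → Pos x → Pos y → Pos (x * y)
pos*pos {x} {y} p q =
  ℚP.positive⁻¹ (x * y) {{ℚP.pos*pos⇒pos x {{ℚ.positive p}} y {{ℚ.positive q}}}}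

nonNeg*nonNeg : ∀ {x y} → NonNeg x → NonNeg y → NonNeg (x * y)
nonNeg*nonNeg {x} {y} p q =
  ℚP.nonNegative⁻¹ (x * y) {{ℚP.nonNeg*nonNeg⇒nonNeg x {{ℚ.nonNegative p}} y {{ℚ.nonNegative q}}}}

neg⇒pos : ∀ {x} → x ℚ.< 0ℚ → Pos (- x)
neg⇒pos = ℚP.neg-antimono-<

nonPos⇒nonNeg : ∀ {x} → x ℚ.≤ 0ℚ → NonNeg (- x)
nonPos⇒nonNeg = ℚP.neg-antimono-≤

pos-cancelˡ : ∀ {w z} → Pos w → Pos (w * z) → Pos z
pos-cancelˡ {w} {z} w>0 wz>0 =
  ℚP.*-cancelˡ-<-nonNeg w {{ℚ.nonNegative (pos⇒nonNeg w>0)}}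
    (subst (ℚ._< w * z) (sym (ℚP.*-zeroʳ w)) wz>0)

pos+nonNeg≢0 : ∀ {p q} → Pos p → NonNeg q → p + q ≡ 0ℚ → ⊥
pos+nonNeg≢0 p q e = ℚP.<-irrefl refl (subst (0ℚ ℚ.<_) e (pos+nonNeg p q))

<⇒pos-diff : ∀ {p q} → p ℚ.< q → Pos (q - p)
<⇒pos-diff {p} {q} h = subst (ℚ._< q - p) (ℚP.+-inverseʳ p) (ℚP.+-monoˡ-< (- p) h)

≤⇒nonNeg-diff : ∀ {p q} → p ℚ.≤ q → NonNeg (q - p)
≤⇒nonNeg-diff {p} {q} h = subst (ℚ._≤ q - p) (ℚP.+-inverseʳ p) (ℚP.+-monoˡ-≤ (- p) h)

pos-diff⇒< : ∀ {p q} → Pos (q - p) → p ℚ.< q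
pos-diff⇒< {p} {q} h = subst₂ ℚ._<_ (ℚP.+-identityˡ p) q-p+p≡q (ℚP.+-monoˡ-< p h)
  where
  q-p+p≡q : q - p + p ≡ q
  q-p+p≡q = solve 2 (λ p q → q :- p :+ p := q) refl p q

square-nonNeg : ∀ x → NonNeg (x * x)
square-nonNeg x with ℚP.≤-total 0ℚ x
... | inj₁ x≥0 = nonNeg*nonNeg x≥0 x≥0
... | inj₂ x≤0 = subst NonNeg (neg*neg x) (nonNeg*nonNeg (nonPos⇒nonNeg x≤0) (nonPos⇒nonNeg x≤0))
  where
  neg*neg : ∀ x → - x * - x ≡ x * x
  neg*neg = solve 1 (λ x → (:- x) :* (:- x) := x :* x) refl

square-mono : ∀ x y → NonNeg x → Pos (y - x) → Pos (y * y - x * x)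
square-mono x y x≥0 y>x =
  subst Pos expand (pos+nonNeg (pos*pos y>x y>x) (nonNeg*nonNeg (nonNeg*nonNeg {lit 2} (by-eval≤ _) x≥0) (pos⇒nonNeg y>x)))
  where
  expand : (y - x) * (y - x) + (lit 2 * x) * (y - x) ≡ y * y - x * x
  expand = solve 2 (λ x y → (y :- x) :* (y :- x) :+ (con (lit 2) :* x) :* (y :- x) := y :* y :- x :* x) refl x y

square-reflect : ∀ x y → NonNeg y → Pos (y * y - x * x) → Pos (y - x)
square-reflect x y y≥0 y²>x² with 0ℚ ℚP.<? (y - x)
... | yes y>x = y>x
... | no  y≯x = ⊥-elim (pos+nonNeg≢0 y²>x² rest cancels)
  where
  x-y≥0 : NonNeg (- (y - x))
  x-y≥0 = nonPos⇒nonNeg (ℚP.≮⇒≥ y≯x)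
  rest : NonNeg (- (y - x) * - (y - x) + (lit 2 * y) * - (y - x))
  rest = nonNeg+nonNeg (nonNeg*nonNeg x-y≥0 x-y≥0) (nonNeg*nonNeg (nonNeg*nonNeg {lit 2} (by-eval≤ _) y≥0) x-y≥0)
  cancels : (y * y - x * x) + (- (y - x) * - (y - x) + (lit 2 * y) * - (y - x)) ≡ 0ℚ
  cancels = solve 2 (λ x y → (y :* y :- x :* x) :+ ((:- (y :- x)) :* (:- (y :- x)) :+ (con (lit 2) :* y) :* (:- (y :- x))) := con 0ℚ) refl x y

-- Lower and upper witnesses for a + b√5 > 0. A lower witness is a rational
-- u/w < √5 (u ≥ 0, w > 0, u² < 5w²) at which the linear form a + b·t is
-- positive; an upper witness is the same with u/w > √5. The form is written
-- homogeneously, a·w + b·u, to avoid division.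
record Lower (a b : ℚ) : Set where
  constructor lower
  field
    u w      : ℚ
    u≥0      : NonNeg u
    w>0      : Pos w
    below-√5 : Pos (five * (w * w) - u * u)
    value>0  : Pos (a * w + b * u)

record Upper (a b : ℚ) : Set where
  constructor upper
  field
    u w      : ℚ
    u≥0      : NonNeg u
    w>0      : Pos w
    above-√5 : Pos (u * u - five * (w * w))
    value>0  : Pos (a * w + b * u)

-- a + b√5 is bracketed if it has both kinds of witness; this will turn out
-- to be equivalent to Positive (a +√5· b).
Bracketed : ℚ → ℚ → Set
Bracketed a b = Lower a b × Upper a b

lower≤upper : ∀ {a b c d} (l : Lower a b) (h : Upper c d) →
  NonNeg (Upper.u h * Lower.w l - Lower.u l * Upper.w h)
lower≤upper (lower u w _ w>0 u²<5w² _) (upper U W U≥0 W>0 U²>5W² _) =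
  pos⇒nonNeg (square-reflect (u * W) (U * w) (nonNeg*nonNeg U≥0 (pos⇒nonNeg w>0))
    (subst Pos cross (pos+nonNeg (pos*pos u²<5w² (pos*pos W>0 W>0)) (pos⇒nonNeg (pos*pos U²>5W² (pos*pos w>0 w>0))))))
  where
  cross : (five * (w * w) - u * u) * (W * W) + (U * U - five * (W * W)) * (w * w)
        ≡ (U * w) * (U * w) - (u * W) * (u * W)
  cross = solve 4 (λ u w U W → (con five :* (w :* w) :- u :* u) :* (W :* W) :+ (U :* U :- con five :* (W :* W)) :* (w :* w)
                             := (U :* w) :* (U :* w) :- (u :* W) :* (u :* W)) refl u w U W

-- A linear form that is positive at a lower and at an upper witness point is
-- positive at every point u'/w' in between (it is monotone in t).
between : ∀ {a b} (l : Lower a b) (h : Upper a b) u' w' → Pos w' →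
  NonNeg (u' * Lower.w l - Lower.u l * w') → NonNeg (Upper.u h * w' - u' * Upper.w h) →
  Pos (a * w' + b * u')
between {a} {b} (lower u w _ w>0 _ at-u) (upper U W _ W>0 _ at-U) u' w' w'>0 u≤u' u'≤U
  with ℚP.≤-total 0ℚ b
... | inj₁ b≥0 = pos-cancelˡ w>0 (subst Pos from-below (pos+nonNeg (pos*pos w'>0 at-u) (nonNeg*nonNeg b≥0 u≤u')))
  where
  from-below : w' * (a * w + b * u) + b * (u' * w - u * w') ≡ w * (a * w' + b * u')
  from-below = solve 6 (λ a b u w u' w' → w' :* (a :* w :+ b :* u) :+ b :* (u' :* w :- u :* w')
                                        := w :* (a :* w' :+ b :* u')) refl a b u w u' w'
... | inj₂ b≤0 = pos-cancelˡ W>0 (subst Pos from-above (pos+nonNeg (pos*pos w'>0 at-U) (nonNeg*nonNeg (nonPos⇒nonNeg b≤0) u'≤U)))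
  where
  from-above : w' * (a * W + b * U) + (- b) * (U * w' - u' * W) ≡ W * (a * w' + b * u')
  from-above = solve 6 (λ a b U W u' w' → w' :* (a :* W :+ b :* U) :+ (:- b) :* (U :* w' :- u' :* W)
                                        := W :* (a :* w' :+ b :* u')) refl a b U W u' w'

form-+ : ∀ a b c d u w → (a * w + b * u) + (c * w + d * u) ≡ (a + c) * w + (b + d) * u
form-+ = solve 6 (λ a b c d u w → (a :* w :+ b :* u) :+ (c :* w :+ d :* u) := (a :+ c) :* w :+ (b :+ d) :* u) refl

-- Brackets add: for the sum use the larger lower point and the smaller upper
-- point; by `between` both summands are positive there.
bracketed-+ : ∀ {a b c d} → Bracketed a b → Bracketed c d → Bracketed (a + c) (b + d)
bracketed-+ {a} {b} {c} {d} (lx , hx) (ly , hy) = lower-sum , upper-sum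
  where
  lower-sum : Lower (a + c) (b + d)
  lower-sum with ℚP.≤-total (Lower.u lx * Lower.w ly) (Lower.u ly * Lower.w lx)
  ... | inj₁ lx≤ly = lower (Lower.u ly) (Lower.w ly) (Lower.u≥0 ly) (Lower.w>0 ly) (Lower.below-√5 ly)
    (subst Pos (form-+ a b c d _ _) (pos+nonNeg
      (between lx hx (Lower.u ly) (Lower.w ly) (Lower.w>0 ly) (≤⇒nonNeg-diff lx≤ly) (lower≤upper ly hx))
      (pos⇒nonNeg (Lower.value>0 ly))))
  ... | inj₂ ly≤lx = lower (Lower.u lx) (Lower.w lx) (Lower.u≥0 lx) (Lower.w>0 lx) (Lower.below-√5 lx)
    (subst Pos (form-+ a b c d _ _) (pos+nonNeg (Lower.value>0 lx)
      (pos⇒nonNeg (between ly hy (Lower.u lx) (Lower.w lx) (Lower.w>0 lx) (≤⇒nonNeg-diff ly≤lx) (lower≤upper lx hy)))))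
  upper-sum : Upper (a + c) (b + d)
  upper-sum with ℚP.≤-total (Upper.u hx * Upper.w hy) (Upper.u hy * Upper.w hx)
  ... | inj₁ hx≤hy = upper (Upper.u hx) (Upper.w hx) (Upper.u≥0 hx) (Upper.w>0 hx) (Upper.above-√5 hx)
    (subst Pos (form-+ a b c d _ _) (pos+nonNeg (Upper.value>0 hx)
      (pos⇒nonNeg (between ly hy (Upper.u hx) (Upper.w hx) (Upper.w>0 hx) (lower≤upper ly hx) (≤⇒nonNeg-diff hx≤hy)))))
  ... | inj₂ hy≤hx = upper (Upper.u hy) (Upper.w hy) (Upper.u≥0 hy) (Upper.w>0 hy) (Upper.above-√5 hy)
    (subst Pos (form-+ a b c d _ _) (pos+nonNeg
      (between lx hx (Upper.u hy) (Upper.w hy) (Upper.w>0 hy) (lower≤upper lx hy) (≤⇒nonNeg-diff hy≤hx))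
      (pos⇒nonNeg (Upper.value>0 hy))))

-- In the mixed-sign clauses the strict inequality between 5b² and a² squeezes a
-- witness between √5 and the root t = |a/b| of the form: for t > √5 the point
-- (t² + 5)/(2t), for t < √5 the point 10t/(t² + 5).
positive⇒bracketed : ∀ a b → Positive (a +√5· b) → Bracketed a b
positive⇒bracketed a b (inj₁ (a>0 , b≥0)) =
  lower 0ℚ 1ℚ (by-eval≤ _) (by-eval< _) (by-eval< _) (subst Pos at-0 a>0) ,
  upper (lit 3) 1ℚ (by-eval≤ _) (by-eval< _) (by-eval< _) (subst Pos at-3 (pos+nonNeg a>0 (nonNeg*nonNeg {b} {lit 3} b≥0 (by-eval≤ _))))
  where
  at-0 : a ≡ a * 1ℚ + b * 0ℚ
  at-0 = solve 2 (λ a b → a := a :* con 1ℚ :+ b :* con 0ℚ) refl a b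
  at-3 : a + b * lit 3 ≡ a * 1ℚ + b * lit 3
  at-3 = solve 2 (λ a b → a :+ b :* con (lit 3) := a :* con 1ℚ :+ b :* con (lit 3)) refl a b
positive⇒bracketed a b (inj₂ (inj₁ (a≥0 , b>0))) =
  lower (lit 2) 1ℚ (by-eval≤ _) (by-eval< _) (by-eval< _) (subst Pos at-2 (pos+nonNeg (pos*pos {b} {lit 2} b>0 (by-eval< _)) a≥0)) ,
  upper (lit 3) 1ℚ (by-eval≤ _) (by-eval< _) (by-eval< _) (subst Pos at-3 (pos+nonNeg (pos*pos {b} {lit 3} b>0 (by-eval< _)) a≥0))
  where
  at-2 : b * lit 2 + a ≡ a * 1ℚ + b * lit 2
  at-2 = solve 2 (λ a b → b :* con (lit 2) :+ a := a :* con 1ℚ :+ b :* con (lit 2)) refl a b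
  at-3 : b * lit 3 + a ≡ a * 1ℚ + b * lit 3
  at-3 = solve 2 (λ a b → b :* con (lit 3) :+ a := a :* con 1ℚ :+ b :* con (lit 3)) refl a b
positive⇒bracketed a b (inj₂ (inj₂ (inj₁ (a>0 , b<0 , 5b²<a²)))) =
  lower 0ℚ 1ℚ (by-eval≤ _) (by-eval< _) (by-eval< _) (subst Pos at-0 a>0) ,
  upper (a * a + five * (b * b)) (lit 2 * (a * (- b)))
    (nonNeg+nonNeg (square-nonNeg a) (nonNeg*nonNeg {five} (by-eval≤ _) (square-nonNeg b)))
    (pos*pos {lit 2} (by-eval< _) (pos*pos a>0 -b>0))
    (subst Pos above (pos*pos n>0 n>0))
    (subst Pos value (pos*pos -b>0 n>0))
  where
  -b>0 : Pos (- b)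
  -b>0 = neg⇒pos b<0
  n>0 : Pos (a * a - five * (b * b))
  n>0 = <⇒pos-diff 5b²<a²
  at-0 : a ≡ a * 1ℚ + b * 0ℚ
  at-0 = solve 2 (λ a b → a := a :* con 1ℚ :+ b :* con 0ℚ) refl a b
  above : (a * a - five * (b * b)) * (a * a - five * (b * b))
        ≡ (a * a + five * (b * b)) * (a * a + five * (b * b)) - five * ((lit 2 * (a * (- b))) * (lit 2 * (a * (- b))))
  above = solve 2 (λ a b → (a :* a :- con five :* (b :* b)) :* (a :* a :- con five :* (b :* b))
    := (a :* a :+ con five :* (b :* b)) :* (a :* a :+ con five :* (b :* b)) :- con five :* ((con (lit 2) :* (a :* (:- b))) :* (con (lit 2) :* (a :* (:- b))))) refl a b
  value : (- b) * (a * a - five * (b * b)) ≡ a * (lit 2 * (a * (- b))) + b * (a * a + five * (b * b))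
  value = solve 2 (λ a b → (:- b) :* (a :* a :- con five :* (b :* b))
    := a :* (con (lit 2) :* (a :* (:- b))) :+ b :* (a :* a :+ con five :* (b :* b))) refl a b
positive⇒bracketed a b (inj₂ (inj₂ (inj₂ (a<0 , b>0 , a²<5b²)))) =
  lower (lit 10 * ((- a) * b)) (a * a + five * (b * b))
    (nonNeg*nonNeg {lit 10} (by-eval≤ _) (pos⇒nonNeg (pos*pos -a>0 b>0)))
    (subst Pos sum-of-squares (pos+nonNeg (pos*pos {five} (by-eval< _) (pos*pos b>0 b>0)) (square-nonNeg a)))
    (subst Pos below (pos*pos {five} (by-eval< _) (pos*pos m>0 m>0)))
    (subst Pos value (pos*pos -a>0 m>0)) ,
  upper (lit 3) 1ℚ (by-eval≤ _) (by-eval< _) (by-eval< _)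
    (subst Pos at-3 (square-reflect (- a) (lit 3 * b) (nonNeg*nonNeg {lit 3} (by-eval≤ _) (pos⇒nonNeg b>0))
      (subst Pos squares (pos+nonNeg m>0 (nonNeg*nonNeg {lit 4} (by-eval≤ _) (square-nonNeg b))))))
  where
  -a>0 : Pos (- a)
  -a>0 = neg⇒pos a<0
  m>0 : Pos (five * (b * b) - a * a)
  m>0 = <⇒pos-diff a²<5b²
  sum-of-squares : five * (b * b) + a * a ≡ a * a + five * (b * b)
  sum-of-squares = solve 2 (λ a b → con five :* (b :* b) :+ a :* a := a :* a :+ con five :* (b :* b)) refl a b
  below : five * ((five * (b * b) - a * a) * (five * (b * b) - a * a))
        ≡ five * ((a * a + five * (b * b)) * (a * a + five * (b * b))) - (lit 10 * ((- a) * b)) * (lit 10 * ((- a) * b))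
  below = solve 2 (λ a b → con five :* ((con five :* (b :* b) :- a :* a) :* (con five :* (b :* b) :- a :* a))
    := con five :* ((a :* a :+ con five :* (b :* b)) :* (a :* a :+ con five :* (b :* b))) :- (con (lit 10) :* ((:- a) :* b)) :* (con (lit 10) :* ((:- a) :* b))) refl a b
  value : (- a) * (five * (b * b) - a * a) ≡ a * (a * a + five * (b * b)) + b * (lit 10 * ((- a) * b))
  value = solve 2 (λ a b → (:- a) :* (con five :* (b :* b) :- a :* a)
    := a :* (a :* a :+ con five :* (b :* b)) :+ b :* (con (lit 10) :* ((:- a) :* b))) refl a b
  squares : (five * (b * b) - a * a) + lit 4 * (b * b) ≡ (lit 3 * b) * (lit 3 * b) - (- a) * (- a)
  squares = solve 2 (λ a b → (con five :* (b :* b) :- a :* a) :+ con (lit 4) :* (b :* b)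
    := (con (lit 3) :* b) :* (con (lit 3) :* b) :- (:- a) :* (:- a)) refl a b
  at-3 : lit 3 * b - (- a) ≡ a * 1ℚ + b * lit 3
  at-3 = solve 2 (λ a b → con (lit 3) :* b :- (:- a) := a :* con 1ℚ :+ b :* con (lit 3)) refl a b

nonPos-form : ∀ a b u w → a ℚ.≤ 0ℚ → b ℚ.≤ 0ℚ → NonNeg u → NonNeg w → Pos (a * w + b * u) → ⊥
nonPos-form a b u w a≤0 b≤0 u≥0 w≥0 value>0 =
  pos+nonNeg≢0 value>0 (nonNeg+nonNeg (nonNeg*nonNeg (nonPos⇒nonNeg a≤0) w≥0) (nonNeg*nonNeg (nonPos⇒nonNeg b≤0) u≥0)) cancels
  where
  cancels : (a * w + b * u) + ((- a) * w + (- b) * u) ≡ 0ℚ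
  cancels = solve 4 (λ a b u w → (a :* w :+ b :* u) :+ ((:- a) :* w :+ (:- b) :* u) := con 0ℚ) refl a b u w

-- Conversely a bracketed element is positive: in the mixed-sign cases the
-- lower (resp. upper) witness shows the √5-part (resp. the rational part) wins.
bracketed⇒positive : ∀ a b → Bracketed a b → Positive (a +√5· b)
bracketed⇒positive a b (lower u w u≥0 w>0 u²<5w² at-u , upper U W U≥0 W>0 U²>5W² at-U)
  with ℚP.<-cmp 0ℚ b | ℚP.<-cmp 0ℚ a
... | tri≈ _ refl _ | _ = inj₁ (pos-cancelˡ w>0 (subst Pos value at-u) , ℚP.≤-refl)
  where
  value : a * w + 0ℚ * u ≡ w * a
  value = solve 3 (λ a u w → a :* w :+ con 0ℚ :* u := w :* a) refl a u w
... | tri< b>0 _ _ | tri< a>0 _ _ = inj₂ (inj₁ (pos⇒nonNeg a>0 , b>0))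
... | tri< b>0 _ _ | tri≈ _ refl _ = inj₂ (inj₁ (ℚP.≤-refl , b>0))
... | tri< b>0 _ _ | tri> _ _ a<0 =
  inj₂ (inj₂ (inj₂ (a<0 , b>0 , pos-diff⇒< (pos-cancelˡ (pos*pos w>0 w>0)
    (subst Pos scaled (pos+nonNeg bu>-aw (nonNeg*nonNeg (square-nonNeg b) (pos⇒nonNeg u²<5w²))))))))
  where
  rearranged : a * w + b * u ≡ b * u - (- a) * w
  rearranged = solve 4 (λ a b u w → a :* w :+ b :* u := b :* u :- (:- a) :* w) refl a b u w
  bu>-aw : Pos ((b * u) * (b * u) - ((- a) * w) * ((- a) * w))
  bu>-aw = square-mono ((- a) * w) (b * u) (nonNeg*nonNeg (pos⇒nonNeg (neg⇒pos a<0)) (pos⇒nonNeg w>0)) (subst Pos rearranged at-u)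
  scaled : ((b * u) * (b * u) - ((- a) * w) * ((- a) * w)) + (b * b) * (five * (w * w) - u * u)
         ≡ (w * w) * (five * (b * b) - a * a)
  scaled = solve 4 (λ a b u w → ((b :* u) :* (b :* u) :- ((:- a) :* w) :* ((:- a) :* w)) :+ (b :* b) :* (con five :* (w :* w) :- u :* u)
                              := (w :* w) :* (con five :* (b :* b) :- a :* a)) refl a b u w
... | tri> _ _ b<0 | tri< a>0 _ _ =
  inj₂ (inj₂ (inj₁ (a>0 , b<0 , pos-diff⇒< (pos-cancelˡ (pos*pos W>0 W>0)
    (subst Pos scaled (pos+nonNeg aW>-bU (nonNeg*nonNeg (square-nonNeg b) (pos⇒nonNeg U²>5W²))))))))
  where
  rearranged : a * W + b * U ≡ a * W - (- b) * U
  rearranged = solve 4 (λ a b U W → a :* W :+ b :* U := a :* W :- (:- b) :* U) refl a b U W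
  aW>-bU : Pos ((a * W) * (a * W) - ((- b) * U) * ((- b) * U))
  aW>-bU = square-mono ((- b) * U) (a * W) (nonNeg*nonNeg (pos⇒nonNeg (neg⇒pos b<0)) U≥0) (subst Pos rearranged at-U)
  scaled : ((a * W) * (a * W) - ((- b) * U) * ((- b) * U)) + (b * b) * (U * U - five * (W * W))
         ≡ (W * W) * (a * a - five * (b * b))
  scaled = solve 4 (λ a b U W → ((a :* W) :* (a :* W) :- ((:- b) :* U) :* ((:- b) :* U)) :+ (b :* b) :* (U :* U :- con five :* (W :* W))
                              := (W :* W) :* (a :* a :- con five :* (b :* b))) refl a b U W
... | tri> _ _ b<0 | tri≈ _ refl _ = ⊥-elim (nonPos-form a b u w ℚP.≤-refl (ℚP.<⇒≤ b<0) u≥0 (pos⇒nonNeg w>0) at-u)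
... | tri> _ _ b<0 | tri> _ _ a<0 = ⊥-elim (nonPos-form a b u w (ℚP.<⇒≤ a<0) (ℚP.<⇒≤ b<0) u≥0 (pos⇒nonNeg w>0) at-u)

positive-+ : ∀ x y → Positive x → Positive y → Positive (x ⊕ y)
positive-+ (a +√5· b) (c +√5· d) x>0 y>0 =
  bracketed⇒positive (a + c) (b + d) (bracketed-+ (positive⇒bracketed a b x>0) (positive⇒bracketed c d y>0))

λ√5 : ℚ√5
λ√5 = √5 ÷ φ

-- On linear forms it acts through
-- the increasing map t ↦ (5t + 5)/(t + 5) fixing √5: the form of λ·(a + b√5)
-- at the image point is 10 times the form of a + b√5 at t, so witnesses are
-- carried to witnesses.
positive-λ : ∀ x → Positive x → Positive (λ√5 ⊗ x)
positive-λ (a +√5· b) x>0 with positive⇒bracketed a b x>0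
... | lower u w u≥0 w>0 u²<5w² at-u , upper U W U≥0 W>0 U²>5W² at-U =
  bracketed⇒positive λa λb
    ( lower (lit 5 * u + lit 5 * w) (u + lit 5 * w) (moved≥0 u≥0 (pos⇒nonNeg w>0)) (moved>0 u≥0 w>0)
        (subst Pos (below u w) (pos*pos {lit 20} (by-eval< _) u²<5w²)) (subst Pos (value u w) (pos*pos {lit 10} (by-eval< _) at-u))
    , upper (lit 5 * U + lit 5 * W) (U + lit 5 * W) (moved≥0 U≥0 (pos⇒nonNeg W>0)) (moved>0 U≥0 W>0)
        (subst Pos (above U W) (pos*pos {lit 20} (by-eval< _) U²>5W²)) (subst Pos (value U W) (pos*pos {lit 10} (by-eval< _) at-U)))
  where
  λa λb : ℚ
  λa = re λ√5 * a + five * (im λ√5 * b)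
  λb = re λ√5 * b + im λ√5 * a
  moved≥0 : ∀ {u w} → NonNeg u → NonNeg w → NonNeg (lit 5 * u + lit 5 * w)
  moved≥0 u≥0 w≥0 = nonNeg+nonNeg (nonNeg*nonNeg {lit 5} (by-eval≤ _) u≥0) (nonNeg*nonNeg {lit 5} (by-eval≤ _) w≥0)
  moved>0 : ∀ {u w} → NonNeg u → Pos w → Pos (u + lit 5 * w)
  moved>0 {u} {w} u≥0 w>0 = subst Pos (ℚP.+-comm (lit 5 * w) u) (pos+nonNeg (pos*pos {lit 5} (by-eval< _) w>0) u≥0)
  below : ∀ u w → lit 20 * (five * (w * w) - u * u)
        ≡ five * ((u + lit 5 * w) * (u + lit 5 * w)) - (lit 5 * u + lit 5 * w) * (lit 5 * u + lit 5 * w)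
  below = solve 2 (λ u w → con (lit 20) :* (con five :* (w :* w) :- u :* u)
    := con five :* ((u :+ con (lit 5) :* w) :* (u :+ con (lit 5) :* w)) :- (con (lit 5) :* u :+ con (lit 5) :* w) :* (con (lit 5) :* u :+ con (lit 5) :* w)) refl
  above : ∀ u w → lit 20 * (u * u - five * (w * w))
        ≡ (lit 5 * u + lit 5 * w) * (lit 5 * u + lit 5 * w) - five * ((u + lit 5 * w) * (u + lit 5 * w))
  above = solve 2 (λ u w → con (lit 20) :* (u :* u :- con five :* (w :* w))
    := (con (lit 5) :* u :+ con (lit 5) :* w) :* (con (lit 5) :* u :+ con (lit 5) :* w) :- con five :* ((u :+ con (lit 5) :* w) :* (u :+ con (lit 5) :* w))) refl
  value : ∀ u w → lit 10 * (a * w + b * u) ≡ λa * (u + lit 5 * w) + λb * (lit 5 * u + lit 5 * w)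
  value u w = solve 4 (λ a b u w → con (lit 10) :* (a :* w :+ b :* u)
    := (con (re λ√5) :* a :+ con five :* (con (im λ√5) :* b)) :* (u :+ con (lit 5) :* w)
       :+ (con (re λ√5) :* b :+ con (im λ√5) :* a) :* (con (lit 5) :* u :+ con (lit 5) :* w)) refl a b u w

≡-components : ∀ {a b c d} → a ≡ c → b ≡ d → (a +√5· b) ≡ (c +√5· d)
≡-components = cong₂ _+√5·_

0√ 1√ : ℚ√5
0√ = 0ℚ +√5· 0ℚ
1√ = 1ℚ +√5· 0ℚ

⊗-comm : ∀ x y → x ⊗ y ≡ y ⊗ x
⊗-comm (a +√5· b) (c +√5· d) =
  ≡-components (solve 4 (λ a b c d → a :* c :+ con five :* (b :* d) := c :* a :+ con five :* (d :* b)) refl a b c d)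
               (solve 4 (λ a b c d → a :* d :+ b :* c := c :* b :+ d :* a) refl a b c d)

⊗-distribˡ-⊕ : ∀ x y z → x ⊗ (y ⊕ z) ≡ x ⊗ y ⊕ x ⊗ z
⊗-distribˡ-⊕ (a +√5· b) (c +√5· d) (e +√5· f) =
  ≡-components (solve 6 (λ a b c d e f → a :* (c :+ e) :+ con five :* (b :* (d :+ f))
                                       := (a :* c :+ con five :* (b :* d)) :+ (a :* e :+ con five :* (b :* f))) refl a b c d e f)
               (solve 6 (λ a b c d e f → a :* (d :+ f) :+ b :* (c :+ e)
                                       := (a :* d :+ b :* c) :+ (a :* f :+ b :* e)) refl a b c d e f)

ℚ√5-isCommutativeRing : IsCommutativeRing _≡_ _⊕_ _⊗_ neg 0√ 1√
ℚ√5-isCommutativeRing = record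
  { isRing = record
    { +-isAbelianGroup = record
      { isGroup = record
        { isMonoid = record
          { isSemigroup = record
            { isMagma = record { isEquivalence = isEquivalence ; ∙-cong = cong₂ _⊕_ }
            ; assoc = λ { (a +√5· b) (c +√5· d) (e +√5· f) → ≡-components (ℚP.+-assoc a c e) (ℚP.+-assoc b d f) } }
          ; identity = (λ { (a +√5· b) → ≡-components (ℚP.+-identityˡ a) (ℚP.+-identityˡ b) })
                     , (λ { (a +√5· b) → ≡-components (ℚP.+-identityʳ a) (ℚP.+-identityʳ b) }) }
        ; inverse = (λ { (a +√5· b) → ≡-components (ℚP.+-inverseˡ a) (ℚP.+-inverseˡ b) })
                  , (λ { (a +√5· b) → ≡-components (ℚP.+-inverseʳ a) (ℚP.+-inverseʳ b) })
        ; ⁻¹-cong = cong neg }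
      ; comm = λ { (a +√5· b) (c +√5· d) → ≡-components (ℚP.+-comm a c) (ℚP.+-comm b d) } }
    ; *-cong = cong₂ _⊗_
    ; *-assoc = λ { (a +√5· b) (c +√5· d) (e +√5· f) → ≡-components
        (solve 6 (λ a b c d e f → (a :* c :+ con five :* (b :* d)) :* e :+ con five :* ((a :* d :+ b :* c) :* f)
                               := a :* (c :* e :+ con five :* (d :* f)) :+ con five :* (b :* (c :* f :+ d :* e))) refl a b c d e f)
        (solve 6 (λ a b c d e f → (a :* c :+ con five :* (b :* d)) :* f :+ (a :* d :+ b :* c) :* e
                               := a :* (c :* f :+ d :* e) :+ b :* (c :* e :+ con five :* (d :* f))) refl a b c d e f) }
    ; *-identity = ⊗-identityˡ , (λ x → trans (⊗-comm x 1√) (⊗-identityˡ x))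
    ; distrib = ⊗-distribˡ-⊕
              , (λ x y z → trans (⊗-comm (y ⊕ z) x) (trans (⊗-distribˡ-⊕ x y z) (cong₂ _⊕_ (⊗-comm x y) (⊗-comm x z)))) }
  ; *-comm = ⊗-comm }
  where
  ⊗-identityˡ : ∀ x → 1√ ⊗ x ≡ x
  ⊗-identityˡ (a +√5· b) =
    ≡-components (solve 2 (λ a b → con 1ℚ :* a :+ con five :* (con 0ℚ :* b) := a) refl a b)
                 (solve 2 (λ a b → con 1ℚ :* b :+ con 0ℚ :* a := b) refl a b)

ℚ√5-commutativeRing : CommutativeRing 0ℓ 0ℓ
ℚ√5-commutativeRing = record { isCommutativeRing = ℚ√5-isCommutativeRing }

-- Equality is decidable componentwise, as the solver needs to compare constants.
_≟√_ : Decidable {A = ℚ√5} _≡_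
(a +√5· b) ≟√ (c +√5· d) =
  map′ (λ (p , q) → ≡-components p q) (λ e → cong re e , cong im e) (a ℚP.≟ c ×-dec b ℚP.≟ d)

module √-Solver = Algebra.Solver.Ring.Simple (ACR.fromCommutativeRing ℚ√5-commutativeRing) _≟√_
open √-Solver using () renaming (solve to solve√; _:=_ to _⊜_; con to κ; _:+_ to _⊞_; _:*_ to _⊠_; _:-_ to _⊟_)

-- The embedding ℤ → ℚ(√5) is a ring homomorphism; everything reduces to
-- z / 1 being the fraction with numerator z and denominator 1.
z/1≡z : ∀ z → z ℚ./ 1 ≡ mkℚ z 0 (ℕC.sym (ℕC.1-coprimeTo ℤ.∣ z ∣))
z/1≡z (ℤ.+ n)      = ℚP.normalize-coprime (ℕC.sym (ℕC.1-coprimeTo n))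
z/1≡z (ℤ.-[1+ n ]) = cong -_ (ℚP.normalize-coprime (ℕC.sym (ℕC.1-coprimeTo (suc n))))

fromℤ-+ : ∀ x y → fromℤ (x ℤ.+ y) ≡ fromℤ x ⊕ fromℤ y
fromℤ-+ x y = ≡-components (/1-+ x y) refl
  where
  /1-+ : ∀ x y → (x ℤ.+ y) ℚ./ 1 ≡ x ℚ./ 1 + y ℚ./ 1
  /1-+ x y rewrite z/1≡z x | z/1≡z y = cong (ℚ._/ 1) (sym (cong₂ ℤ._+_ (ℤP.*-identityʳ x) (ℤP.*-identityʳ y)))

fromℤ-* : ∀ x y → fromℤ (x ℤ.* y) ≡ fromℤ x ⊗ fromℤ y
fromℤ-* x y = ≡-components (trans (/1-* x y) (solve 2 (λ X Y → X :* Y := X :* Y :+ con five :* (con 0ℚ :* con 0ℚ)) refl (x ℚ./ 1) (y ℚ./ 1)))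
                           (solve 2 (λ X Y → con 0ℚ := X :* con 0ℚ :+ con 0ℚ :* Y) refl (x ℚ./ 1) (y ℚ./ 1))
  where
  /1-* : ∀ x y → (x ℤ.* y) ℚ./ 1 ≡ (x ℚ./ 1) * (y ℚ./ 1)
  /1-* x y rewrite z/1≡z x | z/1≡z y = refl

fromℤ-neg : ∀ x → fromℤ (ℤ.- x) ≡ neg (fromℤ x)
fromℤ-neg x = ≡-components (trans (z/1≡z (ℤ.- x)) (sym (trans (cong -_ (z/1≡z x)) (neg-mkℚ x)))) refl
  where
  neg-mkℚ : ∀ z → - mkℚ z 0 (ℕC.sym (ℕC.1-coprimeTo ℤ.∣ z ∣)) ≡ mkℚ (ℤ.- z) 0 (ℕC.sym (ℕC.1-coprimeTo ℤ.∣ ℤ.- z ∣))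
  neg-mkℚ (ℤ.+ zero)    = refl
  neg-mkℚ (ℤ.+ suc n)   = refl
  neg-mkℚ (ℤ.-[1+ n ])  = refl

fromℤ-- : ∀ x y → fromℤ (x ℤ.- y) ≡ fromℤ x ⊖ fromℤ y
fromℤ-- x y = trans (fromℤ-+ x (ℤ.- y)) (cong (fromℤ x ⊕_) (fromℤ-neg y))

positive-fromℤ : ∀ z → Positive (fromℤ z) → ℤ.0ℤ ℤ.< z
positive-fromℤ z (inj₁ (z>0 , _)) with subst Pos (z/1≡z z) z>0
... | ℚ.*<* 0*1<z*1 = subst (ℤ.0ℤ ℤ.<_) (ℤP.*-identityʳ z) 0*1<z*1
positive-fromℤ z (inj₂ (inj₁ (_ , 0<0)))             = ⊥-elim (ℚP.<-irrefl refl 0<0)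
positive-fromℤ z (inj₂ (inj₂ (inj₁ (_ , 0<0 , _))))  = ⊥-elim (ℚP.<-irrefl refl 0<0)
positive-fromℤ z (inj₂ (inj₂ (inj₂ (_ , 0<0 , _))))  = ⊥-elim (ℚP.<-irrefl refl 0<0)

fromℤ-reflects-< : ∀ i j → fromℤ i <ᵣ fromℤ j → i ℤ.< j
fromℤ-reflects-< i j i<j =
  subst₂ ℤ._<_ (ℤP.+-identityˡ i) (ℤsolve 2 (λ i j → (j ⊝ i) ⊕ℤ i ⊜ℤ j) refl i j)
    (ℤP.+-monoˡ-< i (positive-fromℤ (j ℤ.- i) (subst Positive (sym (fromℤ-- j i)) i<j)))

Positive⁰ : ℚ√5 → Set
Positive⁰ x = x ≡ 0√ ⊎ Positive x

≤ᵣ⇒positive⁰ : ∀ {x y} → x ≤ᵣ y → Positive⁰ (y ⊖ x)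
≤ᵣ⇒positive⁰ {x} (inj₁ refl) = inj₁ (solve√ 1 (λ x → x ⊟ x ⊜ κ 0√) refl x)
≤ᵣ⇒positive⁰ (inj₂ x<y) = inj₂ x<y

positive⁰⇒≤ᵣ : ∀ {x y} → Positive⁰ (y ⊖ x) → x ≤ᵣ y
positive⁰⇒≤ᵣ {x} {y} (inj₁ y-x≡0) = inj₁ (begin
  x              ≡⟨ solve√ 2 (λ x y → x ⊜ y ⊟ (y ⊟ x)) refl x y ⟩
  y ⊖ (y ⊖ x)    ≡⟨ cong (y ⊖_) y-x≡0 ⟩
  y ⊖ 0√         ≡⟨ solve√ 1 (λ y → y ⊟ κ 0√ ⊜ y) refl y ⟩
  y              ∎)
  where open ≡-Reasoning
positive⁰⇒≤ᵣ (inj₂ x<y) = inj₂ x<y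

positive⁰+positive : ∀ {x y} → Positive⁰ x → Positive y → Positive (x ⊕ y)
positive⁰+positive {y = y} (inj₁ refl) y>0 = subst Positive (solve√ 1 (λ y → y ⊜ κ 0√ ⊞ y) refl y) y>0
positive⁰+positive {x} {y} (inj₂ x>0) y>0 = positive-+ x y x>0 y>0

positive⁰-λ : ∀ {x} → Positive⁰ x → Positive⁰ (λ√5 ⊗ x)
positive⁰-λ (inj₁ refl) = inj₁ refl
positive⁰-λ {x} (inj₂ x>0) = inj₂ (positive-λ x x>0)

≤ᵣ-<ᵣ-trans : ∀ {x y z} → x ≤ᵣ y → y <ᵣ z → x <ᵣ z
≤ᵣ-<ᵣ-trans {x} {y} {z} x≤y y<z =
  subst Positive (solve√ 3 (λ x y z → (y ⊟ x) ⊞ (z ⊟ y) ⊜ z ⊟ x) refl x y z) (positive⁰+positive (≤ᵣ⇒positive⁰ x≤y) y<z)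

InUnit : ℚ√5 → Set
InUnit r = Positive⁰ r × Positive (ι 1 ⊖ r)

floor-gap : ∀ x n → fromℤ (n ℤ.+ ℤ.1ℤ) ⊖ x ≡ ι 1 ⊖ frac x n
floor-gap x n = trans (cong (_⊖ x) (fromℤ-+ n ℤ.1ℤ)) (solve√ 3 (λ x N one → (N ⊞ one) ⊟ x ⊜ one ⊟ (x ⊟ N)) refl x (fromℤ n) (ι 1))

floor⇒inUnit : ∀ {x n} → IsFloor x n → InUnit (frac x n)
floor⇒inUnit {x} {n} (n≤x , x<n+1) = ≤ᵣ⇒positive⁰ n≤x , subst Positive (floor-gap x n) x<n+1

inUnit⇒floor : ∀ {x n} → InUnit (frac x n) → IsFloor x n
inUnit⇒floor {x} {n} (frac≥0 , frac<1) = positive⁰⇒≤ᵣ frac≥0 , subst Positive (sym (floor-gap x n)) frac<1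

floor-unique : ∀ {x m n} → IsFloor x m → IsFloor x n → m ≡ n
floor-unique {x} {m} {n} (m≤x , x<m+1) (n≤x , x<n+1) =
  ℤP.≤-antisym (<-suc⇒≤ (fromℤ-reflects-< m (n ℤ.+ ℤ.1ℤ) (≤ᵣ-<ᵣ-trans {fromℤ m} {x} {fromℤ (n ℤ.+ ℤ.1ℤ)} m≤x x<n+1)))
               (<-suc⇒≤ (fromℤ-reflects-< n (m ℤ.+ ℤ.1ℤ) (≤ᵣ-<ᵣ-trans {fromℤ n} {x} {fromℤ (m ℤ.+ ℤ.1ℤ)} n≤x x<m+1)))
  where
  <-suc⇒≤ : ∀ {i j} → i ℤ.< j ℤ.+ ℤ.1ℤ → i ℤ.≤ j
  <-suc⇒≤ {i} {j} i<j+1 = subst (i ℤ.≤_) (trans (cong ℤ.pred (ℤP.+-comm j ℤ.1ℤ)) (ℤP.pred-suc j)) (ℤP.i<j⇒i≤pred[j] i<j+1)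

frac-from-remainder : ∀ {x m n r} → IsFloor x m → frac x n ≡ r → InUnit r → frac x m ≡ r
frac-from-remainder {x} {m} {n} {r} ⌊x⌋≡m x-n≡r r∈unit =
  subst (λ m → frac x m ≡ r) (floor-unique {x} {n} {m} (inUnit⇒floor {x} {n} (subst InUnit (sym x-n≡r) r∈unit)) ⌊x⌋≡m) x-n≡r

-- With f = {kφ} = kφ - a and N = 3a + k one has c(k)·φ = N + λf - φ;
-- this is φ² = φ + 1 together with λφ = √5.
cφ-decomposition : ∀ k a →
  fromℤ (cfun k a) ⊗ φ ≡ (fromℤ (ℤ.+ 3 ℤ.* a ℤ.+ ℤ.+ k) ⊕ λ√5 ⊗ frac (fromℕ k ⊗ φ) a) ⊖ φ
cφ-decomposition k a = begin
  fromℤ (cfun k a) ⊗ φ                               ≡⟨ cong (_⊗ φ) c-cast ⟩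
  (A ⊕ ι 2 ⊗ K ⊖ ι 1) ⊗ φ                            ≡⟨ solve√ 2 (λ A K →
                                                          (A ⊞ κ (ι 2) ⊠ K ⊟ κ (ι 1)) ⊠ κ φ
                                                        ⊜ (κ (ι 3) ⊠ A ⊞ K ⊞ κ λ√5 ⊠ (K ⊠ κ φ ⊟ A)) ⊟ κ φ) refl A K ⟩
  (ι 3 ⊗ A ⊕ K ⊕ λ√5 ⊗ (K ⊗ φ ⊖ A)) ⊖ φ              ≡⟨ cong (λ N → (N ⊕ λ√5 ⊗ (K ⊗ φ ⊖ A)) ⊖ φ) (sym N-cast) ⟩
  (fromℤ (ℤ.+ 3 ℤ.* a ℤ.+ ℤ.+ k) ⊕ λ√5 ⊗ (K ⊗ φ ⊖ A)) ⊖ φ ∎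
  where
  open ≡-Reasoning
  A K : ℚ√5
  A = fromℤ a
  K = fromℕ k
  c-cast : fromℤ (cfun k a) ≡ A ⊕ ι 2 ⊗ K ⊖ ι 1
  c-cast = trans (fromℤ-- (a ℤ.+ ℤ.+ 2 ℤ.* ℤ.+ k) ℤ.1ℤ)
                 (cong (_⊖ ι 1) (trans (fromℤ-+ a (ℤ.+ 2 ℤ.* ℤ.+ k)) (cong (A ⊕_) (fromℤ-* (ℤ.+ 2) (ℤ.+ k)))))
  N-cast : fromℤ (ℤ.+ 3 ℤ.* a ℤ.+ ℤ.+ k) ≡ ι 3 ⊗ A ⊕ K
  N-cast = trans (fromℤ-+ (ℤ.+ 3 ℤ.* a) (ℤ.+ k)) (cong (_⊕ K) (fromℤ-* (ℤ.+ 3) a))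

cφ-remainder : ∀ k a j c → ι j ⊖ φ ≡ c →
  frac (fromℤ (cfun k a) ⊗ φ) (ℤ.+ 3 ℤ.* a ℤ.+ ℤ.+ k ℤ.- ℤ.+ j) ≡ λ√5 ⊗ frac (fromℕ k ⊗ φ) a ⊕ c
cφ-remainder k a j c j-φ≡c = begin
  fromℤ (cfun k a) ⊗ φ ⊖ fromℤ (N ℤ.- ℤ.+ j)      ≡⟨ cong₂ _⊖_ (cφ-decomposition k a) (fromℤ-- N (ℤ.+ j)) ⟩
  ((fromℤ N ⊕ L) ⊖ φ) ⊖ (fromℤ N ⊖ ι j)           ≡⟨ solve√ 3 (λ N L J → ((N ⊞ L) ⊟ κ φ) ⊟ (N ⊟ J) ⊜ L ⊞ (J ⊟ κ φ))
                                                         refl (fromℤ N) L (ι j) ⟩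
  L ⊕ (ι j ⊖ φ)                                   ≡⟨ cong (L ⊕_) j-φ≡c ⟩
  L ⊕ c                                           ∎
  where
  open ≡-Reasoning
  N : ℤ
  N = ℤ.+ 3 ℤ.* a ℤ.+ ℤ.+ k
  L : ℚ√5
  L = λ√5 ⊗ frac (fromℕ k ⊗ φ) a

-- If 1/√5 < f < 1 then λf + (1 - √5)/2 ∈ [0, 1): it equals λ(f - 1/√5),
-- and 1 minus it equals λ(1 - f) + (√5 - 2).
range-above : ∀ f → ι 1 ÷ √5 <ᵣ f → Positive (ι 1 ⊖ f) → InUnit (λ√5 ⊗ f ⊕ ((ι 1 ⊖ √5) ÷ ι 2))
range-above f f>1/√5 f<1 =
  inj₂ (subst Positive (solve√ 1 (λ f → κ λ√5 ⊠ (f ⊟ κ (ι 1 ÷ √5)) ⊜ κ λ√5 ⊠ f ⊞ κ ((ι 1 ⊖ √5) ÷ ι 2)) refl f)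
                       (positive-λ (f ⊖ ι 1 ÷ √5) f>1/√5)) ,
  subst Positive (solve√ 1 (λ f → κ λ√5 ⊠ (κ (ι 1) ⊟ f) ⊞ (κ √5 ⊟ κ (ι 2)) ⊜ κ (ι 1) ⊟ (κ λ√5 ⊠ f ⊞ κ ((ι 1 ⊖ √5) ÷ ι 2))) refl f)
    (positive-+ (λ√5 ⊗ (ι 1 ⊖ f)) (√5 ⊖ ι 2) (positive-λ (ι 1 ⊖ f) f<1) √5>2)
  where
  √5>2 : Positive (√5 ⊖ ι 2)
  √5>2 = inj₂ (inj₂ (inj₂ (by-eval< _ , by-eval< _ , by-eval< _)))

-- If 0 ≤ f < 1/√5 then λf + (3 - √5)/2 ∈ [0, 1): it is at least (3 - √5)/2 > 0,
-- and 1 minus it equals λ(1/√5 - f).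
range-below : ∀ f → Positive⁰ f → f <ᵣ ι 1 ÷ √5 → InUnit (λ√5 ⊗ f ⊕ ((ι 3 ⊖ √5) ÷ ι 2))
range-below f f≥0 f<1/√5 =
  inj₂ (positive⁰+positive (positive⁰-λ f≥0) 3-√5>0) ,
  subst Positive (solve√ 1 (λ f → κ λ√5 ⊠ (κ (ι 1 ÷ √5) ⊟ f) ⊜ κ (ι 1) ⊟ (κ λ√5 ⊠ f ⊞ κ ((ι 3 ⊖ √5) ÷ ι 2))) refl f)
    (positive-λ (ι 1 ÷ √5 ⊖ f) f<1/√5)
  where
  3-√5>0 : Positive ((ι 3 ⊖ √5) ÷ ι 2)
  3-√5>0 = inj₂ (inj₂ (inj₁ (by-eval< _ , by-eval< _ , by-eval< _)))

theorem4p4 : (k : ℕ) → 1 ≤ k → (a : ℤ) → IsFloor (fromℕ k ⊗ φ) a →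
    (m : ℤ) → IsFloor (fromℤ (cfun k a) ⊗ φ) m →
      (ι 1 ÷ √5 <ᵣ frac (fromℕ k ⊗ φ) a →
         frac (fromℤ (cfun k a) ⊗ φ) m ≡ (√5 ÷ φ) ⊗ frac (fromℕ k ⊗ φ) a ⊕ ((ι 1 ⊖ √5) ÷ ι 2))
      × (frac (fromℕ k ⊗ φ) a <ᵣ ι 1 ÷ √5 →
         frac (fromℤ (cfun k a) ⊗ φ) m ≡ (√5 ÷ φ) ⊗ frac (fromℕ k ⊗ φ) a ⊕ ((ι 3 ⊖ √5) ÷ ι 2))
theorem4p4 k _ a ⌊kφ⌋≡a m ⌊cφ⌋≡m = above , below
  where
  f cφ : ℚ√5
  f = frac (fromℕ k ⊗ φ) a
  cφ = fromℤ (cfun k a) ⊗ φ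
  N : ℤ
  N = ℤ.+ 3 ℤ.* a ℤ.+ ℤ.+ k
  f∈unit : InUnit f
  f∈unit = floor⇒inUnit {fromℕ k ⊗ φ} {a} ⌊kφ⌋≡a
  above : ι 1 ÷ √5 <ᵣ f → frac cφ m ≡ λ√5 ⊗ f ⊕ ((ι 1 ⊖ √5) ÷ ι 2)
  above f>1/√5 = frac-from-remainder {cφ} {m} {N ℤ.- ℤ.+ 1} ⌊cφ⌋≡m (cφ-remainder k a 1 _ refl) (range-above f f>1/√5 (proj₂ f∈unit))
  below : f <ᵣ ι 1 ÷ √5 → frac cφ m ≡ λ√5 ⊗ f ⊕ ((ι 3 ⊖ √5) ÷ ι 2)
  below f<1/√5 = frac-from-remainder {cφ} {m} {N ℤ.- ℤ.+ 2} ⌊cφ⌋≡m (cφ-remainder k a 2 _ refl) (range-below f (proj₁ f∈unit) f<1/√5)
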